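{- For all $k,n,m\geqslant 0$, the square consisting of $K=C^{n\ast}_{k+m}$, $M=C^{n+1\ast}_{k+m}$, $N=C^{n\ast}_{k+1+m}$, $L=C^{n+1\ast}_{k+1+m}$ and the maps $f\colon K\to M$, $(x_1,\dots,x_n)\mapsto(0,x_1,\dots,x_n)$; $g\colon K\to N$, $(x_1,\dots,x_n)\mapsto(x_1+1,\dots,x_n+1)$; $f'\colon N\to L$, $(z_1,\dots,z_n)\mapsto(0,z_1,\dots,z_n)$; $g'\colon M\to L$, $(y_1,\dots,y_{n+1})\mapsto(y_1+1,\dots,y_{n+1}+1)$ is a lax pushout.
   Context: $C_r$ is the chain $\{0<1<\dots<r\}$ and $C^n_r$ its $n$-th cartesian power with componentwise order. For $r\geqslant k$, $C^{n\ast}_{r}$ (with $r$ written as $k+m$) denotes the subposet of $C^n_{k+m}$ of those $(x_1,\dots,x_n)$ such that for each $i\in\{1,\dots,n-1\}$, if $x_{i+1}\in\{0,\dots,k-1\}$ then $x_i\leqslant x_{i+1}$; in $C^{n\ast}_{k+1+m}$ and $C^{n+1\ast}_{k+1+m}$ the threshold is $k+1$, i.e., the condition reads: if $x_{i+1}\in\{0,\dots,k\}$ then $x_i\leqslant x_{i+1}$. (The maps above respect these conditions.) A square of posets and monotone maps $f\colon K\to M$, $g\colon K\to N$, $f'\colon N\to L$, $g'\colon M\to L$ is a lax pushout if: $f'$ and $g'$ are order-reflecting (hence injective) with disjoint images whose union is $L$; the image of $f'$ is down-closed; and for all $a\in N$, $b\in M$, $f'(a)\leqslant g'(b)$ holds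 iff there is $c\in K$ with $a\leqslant g(c)$ and $f(c)\leqslant b$. -}

module Defs where

open import Data.Nat using (ℕ; zero; suc; _≤_; _<_; z≤n; s≤s)
open import Data.Vec using (Vec; []; _∷_; map)
open import Data.Vec.Relation.Unary.All using (All; []; _∷_)
open import Data.Vec.Relation.Binary.Pointwise.Inductive using (Pointwise)
open import Data.Unit using (⊤; tt)
open import Data.Product using (_×_; _,_; ∃)
open import Data.Sum using (_⊎_)
open import Relation.Nullary using (¬_)
open import Relation.Binary.PropositionalEquality using (_≡_)
open import Function.Bundles using (_⇔_)

Adm : ∀ {n} → ℕ → Vec ℕ n → Set
Adm t [] = ⊤
Adm t (x ∷ []) = ⊤
Adm t (x ∷ y ∷ xs) = (y < t → x ≤ y) × Adm t (y ∷ xs)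

-- C^{n*}_{k+m} = Star k (k+m) n ; C^{n*}_{k+1+m} = Star (suc k) (suc k + m) n.
record Star (t r n : ℕ) : Set where
  constructor mk
  field
    vec   : Vec ℕ n
    bound : All (_≤ r) vec
    adm   : Adm t vec
open Star public

_≤*_ : ∀ {t r n} → Star t r n → Star t r n → Set
a ≤* b = Pointwise _≤_ (vec a) (vec b)

_≈*_ : ∀ {t r n} → Star t r n → Star t r n → Set
a ≈* b = vec a ≡ vec b

private
  adm-cons0 : ∀ {t n} (xs : Vec ℕ n) → Adm t xs → Adm t (0 ∷ xs)
  adm-cons0 [] _ = tt
  adm-cons0 (x ∷ xs) a = (λ _ → z≤n) , a

  adm-suc : ∀ {t n} (xs : Vec ℕ n) → Adm t xs → Adm (suc t) (map suc xs)
  adm-suc [] _ = tt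
  adm-suc (x ∷ []) _ = tt
  adm-suc (x ∷ y ∷ xs) (h , a) =
    (λ { (s≤s y<t) → s≤s (h y<t) }) , adm-suc (y ∷ xs) a

  bound-suc : ∀ {r n} (xs : Vec ℕ n) → All (_≤ r) xs → All (_≤ suc r) (map suc xs)
  bound-suc [] [] = []
  bound-suc (x ∷ xs) (p ∷ ps) = s≤s p ∷ bound-suc xs ps

prepend0 : ∀ {t r n} → Star t r n → Star t r (suc n)
prepend0 (mk xs b a) = mk (0 ∷ xs) (z≤n ∷ b) (adm-cons0 xs a)

shift : ∀ {t r n} → Star t r n → Star (suc t) (suc r) n
shift (mk xs b a) = mk (map suc xs) (bound-suc xs b) (adm-suc xs a)

Monotone : ∀ {A B : Set} → (A → A → Set) → (B → B → Set) → (A → B) → Set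
Monotone _≤A_ _≤B_ h = ∀ {a b} → a ≤A b → h a ≤B h b

record IsLaxPushout {K M N L : Set}
    (_≤K_ : K → K → Set) (_≤M_ : M → M → Set) (_≤N_ : N → N → Set)
    (_≤L_ : L → L → Set) (_≈L_ : L → L → Set)
    (f : K → M) (g : K → N) (f' : N → L) (g' : M → L) : Set where
  field
    f'-reflects : ∀ {a b} → f' a ≤L f' b → a ≤N b
    g'-reflects : ∀ {a b} → g' a ≤L g' b → a ≤M b
    disjoint    : ∀ (a : N) (b : M) → ¬ (f' a ≈L g' b)
    cover       : ∀ (l : L) → (∃ λ (a : N) → f' a ≈L l) ⊎ (∃ λ (b : M) → g' b ≈L l)
    down-closed : ∀ (l : L) (a : N) → l ≤L f' a → ∃ λ (a' : N) → f' a' ≈L l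
    cross       : ∀ (a : N) (b : M) →
                  (f' a ≤L g' b) ⇔ (∃ λ (c : K) → (a ≤N g c) × (f c ≤M b))

-- An element of L = C^{n+1*}_{k+1+m} either starts with 0, and is then f' of its tail, or
-- starts with a positive entry; in the latter case all its entries are positive (a zero
-- entry lies below the threshold k+1 and so forces its predecessor to vanish), and it is
-- g' of its decrement.  Both maps reflect the order, their images are separated by the
-- first coordinate, and f' a ≤ g' b says exactly a ≤ g (tail b), so c = tail b is the
-- witness of the lax-pushout condition; conversely a ≤ g c and f c ≤ b give f' a ≤ g' b.
module Submission where

open import Defs
open import Data.Nat using (ℕ; zero; suc; pred; _+_; _≤_; _<_; z≤n; s≤s)
open import Data.Nat.Properties using (≤-refl; ≤-trans; ≤-pred)
open import Data.Vec using (Vec; []; _∷_; map; head)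
open import Data.Vec.Relation.Unary.All using (All; []; _∷_)
open import Data.Vec.Relation.Binary.Pointwise.Inductive as Pointwise
  using (Pointwise; []; _∷_)
open import Data.Unit using (tt)
open import Data.Product using (_×_; _,_; ∃)
open import Data.Sum using (_⊎_; inj₁; inj₂)
open import Relation.Nullary using (¬_)
open import Relation.Binary.PropositionalEquality using (_≡_; refl; cong)
open import Function.Bundles using (_⇔_; mk⇔)

map-suc⁻ : ∀ {n} {xs ys : Vec ℕ n} →
           Pointwise _≤_ (map suc xs) (map suc ys) → Pointwise _≤_ xs ys
map-suc⁻ {xs = []}    {[]}    []            = []
map-suc⁻ {xs = _ ∷ _} {_ ∷ _} (s≤s p ∷ ps) = p ∷ map-suc⁻ ps

Adm-tail : ∀ {t n x} {xs : Vec ℕ n} → Adm t (x ∷ xs) → Adm t xs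
Adm-tail {xs = []}    _       = tt
Adm-tail {xs = _ ∷ _} (_ , a) = a

Adm-positive : ∀ {t n x} {xs : Vec ℕ n} → 0 < x → Adm (suc t) (x ∷ xs) → All (0 <_) xs
Adm-positive {xs = []}         _   _       = []
Adm-positive {xs = zero ∷ _}   0<x (h , _) with ≤-trans 0<x (h (s≤s z≤n))
... | ()
Adm-positive {xs = suc _ ∷ _} _   (_ , a) = s≤s z≤n ∷ Adm-positive (s≤s z≤n) a

Adm-pred : ∀ {t n} {xs : Vec ℕ n} → All (0 <_) xs → Adm (suc t) xs → Adm t (map pred xs)
Adm-pred {xs = []}                  _                 _       = tt
Adm-pred {xs = _ ∷ []}              _                 _       = tt
Adm-pred {xs = suc _ ∷ suc _ ∷ _} (_ ∷ 0<y ∷ 0<ys) (h , a) =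
  (λ y<t → ≤-pred (h (s≤s y<t))) , Adm-pred (0<y ∷ 0<ys) a

All-≤-pred : ∀ {r n} {xs : Vec ℕ n} → All (_≤ suc r) xs → All (_≤ r) (map pred xs)
All-≤-pred {xs = []}        []           = []
All-≤-pred {xs = zero ∷ _}  (_ ∷ ps)     = z≤n ∷ All-≤-pred ps
All-≤-pred {xs = suc _ ∷ _} (s≤s p ∷ ps) = p ∷ All-≤-pred ps

map-suc-pred : ∀ {n} {xs : Vec ℕ n} → All (0 <_) xs → map suc (map pred xs) ≡ xs
map-suc-pred {xs = []}        []       = refl
map-suc-pred {xs = suc x ∷ _} (_ ∷ ps) = cong (suc x ∷_) (map-suc-pred ps)

behead : ∀ {t r n} → Star t r (suc n) → Star t r n
behead (mk (_ ∷ xs) (_ ∷ b) a) = mk xs b (Adm-tail a)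

unshift : ∀ {t r n} (s : Star (suc t) (suc r) n) → All (0 <_) (vec s) → Star t r n
unshift (mk xs b a) pos = mk (map pred xs) (All-≤-pred b) (Adm-pred pos a)

prepend0-behead : ∀ {t r n} (s : Star t r (suc n)) → head (vec s) ≡ 0 →
                  prepend0 (behead s) ≈* s
prepend0-behead (mk (_ ∷ _) (_ ∷ _) _) refl = refl

shift-unshift : ∀ {t r n} (s : Star (suc t) (suc r) n) (pos : All (0 <_) (vec s)) →
                shift (unshift s pos) ≈* s
shift-unshift (mk _ _ _) pos = map-suc-pred pos

prepend0≉shift : ∀ {t r n} (a : Star (suc t) (suc r) n) (b : Star t r (suc n)) →
                 ¬ (prepend0 a ≈* shift b)
prepend0≉shift (mk _ _ _) (mk (_ ∷ _) (_ ∷ _) _) ()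

prepend0-shift-cover : ∀ {t r n} (l : Star (suc t) (suc r) (suc n)) →
                       (∃ λ a → prepend0 a ≈* l) ⊎ (∃ λ (b : Star t r (suc n)) → shift b ≈* l)
prepend0-shift-cover l@(mk (zero ∷ _) (_ ∷ _) _) = inj₁ (behead l , prepend0-behead l refl)
prepend0-shift-cover l@(mk (suc _ ∷ _) _ a)      = inj₂ (unshift l pos , shift-unshift l pos)
  where pos = s≤s z≤n ∷ Adm-positive (s≤s z≤n) a

prepend0-down-closed : ∀ {t r n} (l : Star t r (suc n)) (a : Star t r n) →
                       l ≤* prepend0 a → ∃ λ a′ → prepend0 a′ ≈* l
prepend0-down-closed l@(mk (zero ∷ _) (_ ∷ _) _) (mk _ _ _) _ = behead l , prepend0-behead l refl
prepend0-down-closed (mk (suc _ ∷ _) _ _) (mk _ _ _) (() ∷ _)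

prepend0≤shift⇔ : ∀ {t r n} (a : Star (suc t) (suc r) n) (b : Star t r (suc n)) →
                  prepend0 a ≤* shift b ⇔ (∃ λ c → (a ≤* shift c) × (prepend0 c ≤* b))
prepend0≤shift⇔ (mk _ _ _) b@(mk (_ ∷ _) (_ ∷ _) _) = mk⇔
  (λ { (_ ∷ a≤b) → behead b , a≤b , z≤n ∷ Pointwise.refl ≤-refl })
  (λ { (c , a≤c , (_ ∷ c≤b)) →
        z≤n ∷ Pointwise.trans ≤-trans a≤c (Pointwise.map⁺ s≤s c≤b) })

lemma4p3 : (k n m : ℕ) →
    let f  = prepend0 {k} {k + m} {n}
        g  = shift {k} {k + m} {n}
        f' = prepend0 {suc k} {suc k + m} {n}
        g' = shift {k} {k + m} {suc n}
    in (Monotone _≤*_ _≤*_ f × Monotone _≤*_ _≤*_ g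
        × Monotone _≤*_ _≤*_ f' × Monotone _≤*_ _≤*_ g')
       × IsLaxPushout _≤*_ _≤*_ _≤*_ _≤*_ _≈*_ f g f' g'
lemma4p3 k n m =
  (z≤n ∷_ , Pointwise.map⁺ s≤s , z≤n ∷_ , Pointwise.map⁺ s≤s) ,
  record
    { f'-reflects = Pointwise.tail
    ; g'-reflects = map-suc⁻
    ; disjoint    = prepend0≉shift
    ; cover       = prepend0-shift-cover
    ; down-closed = prepend0-down-closed
    ; cross       = prepend0≤shift⇔
    }
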